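{- Let $G$ be a graph, let $xy_1y_2y$ be a 2-thread of $G$ and let $xy_3z$ be a 1-thread of $G$, both incident with the vertex $x$. Let $m\ge 4$ be an integer. If $G-\{y_1,y_2,y_3\}$ has an equitable $m$-coloring $f$ with $f(x)\notin\{f(y),f(z)\}$, then $f$ can be extended to an equitable $m$-coloring of $G$.
   Context: A thread in a graph is either a path whose interior vertices all have degree 2 and whose endvertices have degree at least 3, or a cycle with exactly one vertex of degree at least 3 and all other vertices of degree 2; a $k$-thread has $k$ interior vertices of degree 2. Thus $d_G(y_1)=d_G(y_2)=d_G(y_3)=2$. A proper vertex $m$-coloring is equitable if the sizes of any two color classes differ by at most one. Extending $f$ means finding a coloring of $G$ that agrees with $f$ on $G-\{y_1,y_2,y_3\}$. -}

module Defs where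

open import Data.Nat using (ℕ; _≤_; suc)
open import Data.Bool using (Bool; true; false; not; _∨_)
open import Data.Fin using (Fin; _≟_)
open import Data.Fin.Subset using (Subset; _∈_; _∩_; ∣_∣; ⊤)
open import Data.Vec using (tabulate)
open import Relation.Binary.PropositionalEquality using (_≡_; _≢_)
open import Relation.Nullary.Decidable using (⌊_⌋)

record Graph (n : ℕ) : Set where
  field
    adj    : Fin n → Fin n → Bool
    sym    : ∀ u v → adj u v ≡ adj v u
    irrefl : ∀ v → adj v v ≡ false
open Graph public

Adj : ∀ {n} → Graph n → Fin n → Fin n → Set
Adj G u v = adj G u v ≡ true

deg : ∀ {n} → Graph n → Fin n → ℕ
deg G v = ∣ tabulate (adj G v) ∣

-- The 2-thread x a b y (interior vertices a, b).  Either a path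
-- (x ≢ y) or a cycle (x ≡ y); both cases allowed as in the definition.
record TwoThread {n} (G : Graph n) (x a b y : Fin n) : Set where
  field
    x≢a : x ≢ a
    x≢b : x ≢ b
    a≢b : a ≢ b
    a≢y : a ≢ y
    b≢y : b ≢ y
    adj-xa : Adj G x a
    adj-ab : Adj G a b
    adj-by : Adj G b y
    deg-a : deg G a ≡ 2
    deg-b : deg G b ≡ 2
    deg-x : 3 ≤ deg G x
    deg-y : 3 ≤ deg G y

record OneThread {n} (G : Graph n) (x c z : Fin n) : Set where
  field
    x≢c : x ≢ c
    c≢z : c ≢ z
    adj-xc : Adj G x c
    adj-cz : Adj G c z
    deg-c : deg G c ≡ 2
    deg-x : 3 ≤ deg G x
    deg-z : 3 ≤ deg G z

without3 : ∀ {n} → Fin n → Fin n → Fin n → Subset n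
without3 a b c = tabulate (λ v → not (⌊ v ≟ a ⌋ ∨ ⌊ v ≟ b ⌋ ∨ ⌊ v ≟ c ⌋))

ProperOn : ∀ {n m} → Graph n → Subset n → (Fin n → Fin m) → Set
ProperOn G W f = ∀ u v → u ∈ W → v ∈ W → Adj G u v → f u ≢ f v

classSize : ∀ {n m} → Subset n → (Fin n → Fin m) → Fin m → ℕ
classSize W f c = ∣ W ∩ tabulate (λ v → ⌊ f v ≟ c ⌋) ∣

BalancedOn : ∀ {n m} → Subset n → (Fin n → Fin m) → Set
BalancedOn {m = m} W f = ∀ (c d : Fin m) → classSize W f c ≤ suc (classSize W f d)

EquitableOn : ∀ {n m} → Graph n → Subset n → (Fin n → Fin m) → Set
EquitableOn G W f = ProperOn G W f × BalancedOn W f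
  where open import Data.Product using (_×_)

-- Colour y₁, y₂, y₃ with the three colours whose classes under f are smallest.
-- Since f is equitable, every one of these classes is no larger than any other
-- class, so adding one vertex to each of them keeps all class sizes within one
-- of each other.  The three colours can be distributed properly: y₃ gets one
-- avoiding f(x) and f(z), and the other two go to y₁ and y₂, swapped if
-- necessary so that y₁ avoids f(x) and y₂ avoids f(y), which is possible as
-- f(x) ≠ f(y).
module Submission where

open import Defs hiding (sym)
open import Data.Nat using (ℕ; zero; suc; _+_; _≤_; z≤n; s≤s; _≤?_)
open import Data.Nat.Properties using (≤-refl; ≤-trans; ≰⇒≥; m≤n⇒m≤1+n; <⇒≤)
open import Data.Bool using (Bool; true; false; not; _∧_; _∨_)
open import Data.Fin using (Fin; zero; suc; _≟_)
open import Data.Fin.Properties using (suc-injective)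
open import Data.Fin.Subset using (Subset; _∈_; _∉_; _∩_; _-_; ∣_∣; ⊤)
open import Data.Fin.Subset.Properties
  using (_∈?_; ∩-identityˡ; x∈p⇒∣p-x∣<∣p∣; x∈p∧x≢y⇒x∈p-y)
open import Data.Vec using (Vec; _∷_; lookup; tabulate)
open import Data.Vec.Properties
  using (lookup∘tabulate; tabulate∘lookup; tabulate-cong; lookup-zipWith; []=⇒lookup; lookup⇒[]=)
open import Data.Vec.Functional using (updateAt)
open import Data.Vec.Functional.Properties using (updateAt-updates; updateAt-minimal)
open import Data.Product using (Σ; ∃; ∃-syntax; _×_; _,_; proj₁; proj₂; map₂)
open import Data.Sum using (_⊎_; inj₁; inj₂)
open import Data.Empty using (⊥; ⊥-elim)
open import Data.Unit using (tt)
open import Function using (_∘_; const)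
open import Relation.Nullary using (¬_; Dec; yes; no; ¬?)
open import Relation.Nullary.Decidable using (⌊_⌋; _×-dec_; _⊎-dec_)
open import Relation.Unary using (Decidable)
open import Relation.Binary.PropositionalEquality
  using (_≡_; _≢_; refl; sym; trans; cong; subst; ≢-sym; module ≡-Reasoning)

private
  variable
    n m : ℕ

OneOf : {A : Set} → A → A → A → A → Set
OneOf p q r c = c ≡ p ⊎ c ≡ q ⊎ c ≡ r

∈-tabulate⁺ : {p : Fin n → Bool} {v : Fin n} → p v ≡ true → v ∈ tabulate p
∈-tabulate⁺ {p = p} {v} pv = lookup⇒[]= v _ (trans (lookup∘tabulate p v) pv)

∈-tabulate⁻ : {p : Fin n → Bool} {v : Fin n} → v ∈ tabulate p → p v ≡ true
∈-tabulate⁻ {p = p} {v} v∈ = trans (sym (lookup∘tabulate p v)) ([]=⇒lookup v∈)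

∉⇒lookup≡false : {p : Subset n} {v : Fin n} → v ∉ p → lookup p v ≡ false
∉⇒lookup≡false {p = p} {v} v∉p with lookup p v in eq
... | true = ⊥-elim (v∉p (lookup⇒[]= v p eq))
... | false = refl

lookup-ext : {A : Set} (xs ys : Vec A n) → (∀ v → lookup xs v ≡ lookup ys v) → xs ≡ ys
lookup-ext xs ys eq = begin
  xs                 ≡⟨ tabulate∘lookup xs ⟨
  tabulate (lookup xs) ≡⟨ tabulate-cong eq ⟩
  tabulate (lookup ys) ≡⟨ tabulate∘lookup ys ⟩
  ys                 ∎
  where open ≡-Reasoning

∣∷∣-suc : ∀ b (p q : Subset n) → ∣ q ∣ ≡ suc ∣ p ∣ → ∣ b ∷ q ∣ ≡ suc ∣ b ∷ p ∣
∣∷∣-suc true _ _ eq = cong suc eq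
∣∷∣-suc false _ _ eq = eq

∣q∣≡1+∣p∣ : (p q : Subset n) (w : Fin n) → lookup p w ≡ false → lookup q w ≡ true →
  (∀ v → v ≢ w → lookup p v ≡ lookup q v) → ∣ q ∣ ≡ suc ∣ p ∣
∣q∣≡1+∣p∣ (_ ∷ p) (_ ∷ q) zero refl refl eq =
  cong (suc ∘ ∣_∣) (sym (lookup-ext p q (λ v → eq (suc v) (λ ()))))
∣q∣≡1+∣p∣ (a ∷ p) (b ∷ q) (suc w) pw qw eq with eq zero (λ ())
... | refl = ∣∷∣-suc a p q (∣q∣≡1+∣p∣ p q w pw qw (λ v v≢w → eq (suc v) (v≢w ∘ suc-injective)))

3≤∣p∣ : {p : Subset n} {a b c : Fin n} → a ∈ p → b ∈ p → c ∈ p →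
  a ≢ b → a ≢ c → b ≢ c → 3 ≤ ∣ p ∣
3≤∣p∣ a∈p b∈p c∈p a≢b a≢c b≢c =
  ≤-trans (s≤s (≤-trans (s≤s 1≤∣p-a-b∣) (x∈p⇒∣p-x∣<∣p∣ b∈p-a))) (x∈p⇒∣p-x∣<∣p∣ a∈p)
  where
  b∈p-a = x∈p∧x≢y⇒x∈p-y b∈p (≢-sym a≢b)
  c∈p-a-b = x∈p∧x≢y⇒x∈p-y (x∈p∧x≢y⇒x∈p-y c∈p (≢-sym a≢c)) (≢-sym b≢c)
  1≤∣p-a-b∣ = ≤-trans (s≤s z≤n) (x∈p⇒∣p-x∣<∣p∣ c∈p-a-b)

Adj-sym : (G : Graph n) {u v : Fin n} → Adj G u v → Adj G v u
Adj-sym G {u} {v} uv = trans (Graph.sym G v u) uv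

neighbour-of-degree-two : (G : Graph n) {w a b r : Fin n} → deg G w ≡ 2 →
  Adj G w a → Adj G w b → a ≢ b → Adj G w r → r ≡ a ⊎ r ≡ b
neighbour-of-degree-two G {w} {a} {b} {r} deg≡2 wa wb a≢b wr with r ≟ a | r ≟ b
... | yes r≡a | _ = inj₁ r≡a
... | no _ | yes r≡b = inj₂ r≡b
... | no r≢a | no r≢b with 3≤∣p∣ (∈-tabulate⁺ wa) (∈-tabulate⁺ wb) (∈-tabulate⁺ wr)
                             a≢b (≢-sym r≢a) (≢-sym r≢b)
...   | 3≤deg rewrite deg≡2 with 3≤deg
...     | s≤s (s≤s ())

degree-two≢degree-≥3 : (G : Graph n) {u v : Fin n} → deg G u ≡ 2 → 3 ≤ deg G v → u ≢ v
degree-two≢degree-≥3 _ deg≡2 3≤deg refl with 3≤deg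
... | 3≤2 rewrite deg≡2 with 3≤2
...   | s≤s (s≤s ())

∈without3⁺ : {a b c v : Fin n} → v ≢ a → v ≢ b → v ≢ c → v ∈ without3 a b c
∈without3⁺ {a = a} {b} {c} {v} v≢a v≢b v≢c = ∈-tabulate⁺ none
  where
  none : not (⌊ v ≟ a ⌋ ∨ ⌊ v ≟ b ⌋ ∨ ⌊ v ≟ c ⌋) ≡ true
  none with v ≟ a | v ≟ b | v ≟ c
  ... | yes v≡a | _ | _ = ⊥-elim (v≢a v≡a)
  ... | no _ | yes v≡b | _ = ⊥-elim (v≢b v≡b)
  ... | no _ | no _ | yes v≡c = ⊥-elim (v≢c v≡c)
  ... | no _ | no _ | no _ = refl

∈without3⁻ : {a b c v : Fin n} → v ∈ without3 a b c → v ≢ a × v ≢ b × v ≢ c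
∈without3⁻ {a = a} {b} {c} {v} v∈ with v ≟ a | v ≟ b | v ≟ c | ∈-tabulate⁻ v∈
... | no v≢a | no v≢b | no v≢c | _ = v≢a , v≢b , v≢c
... | yes _ | _ | _ | ()
... | no _ | yes _ | _ | ()
... | no _ | no _ | yes _ | ()

∉without3⁻ : {a b c v : Fin n} → v ∉ without3 a b c → OneOf a b c v
∉without3⁻ {a = a} {b} {c} {v} v∉ with v ≟ a | v ≟ b | v ≟ c
... | yes v≡a | _ | _ = inj₁ v≡a
... | no _ | yes v≡b | _ = inj₂ (inj₁ v≡b)
... | no _ | no _ | yes v≡c = inj₂ (inj₂ v≡c)
... | no v≢a | no v≢b | no v≢c = ⊥-elim (v∉ (∈without3⁺ v≢a v≢b v≢c))

a∉without3 : {a b c : Fin n} → a ∉ without3 a b c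
a∉without3 a∈ = proj₁ (∈without3⁻ a∈) refl

b∉without3 : {a b c : Fin n} → b ∉ without3 a b c
b∉without3 b∈ = proj₁ (proj₂ (∈without3⁻ b∈)) refl

c∉without3 : {a b c : Fin n} → c ∉ without3 a b c
c∉without3 c∈ = proj₂ (proj₂ (∈without3⁻ c∈)) refl

-- Extending a colouring

colourClass : (Fin n → Fin m) → Fin m → Subset n
colourClass f c = tabulate (λ v → ⌊ f v ≟ c ⌋)

module _ {W : Subset n} {f g : Fin n → Fin m}
         (g-agrees : ∀ v → v ∈ W → g v ≡ f v) where

  properOn-extend : {G : Graph n} → ProperOn G W f →
    (∀ u v → u ∉ W → Adj G u v → g u ≢ g v) → ProperOn G ⊤ g
  properOn-extend {G} f-proper outer u v _ _ uv with u ∈? W | v ∈? W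
  ... | no u∉W | _ = outer u v u∉W uv
  ... | yes _ | no v∉W = outer v u v∉W (Adj-sym G uv) ∘ sym
  ... | yes u∈W | yes v∈W = λ gu≡gv → f-proper u v u∈W v∈W uv
          (trans (sym (g-agrees u u∈W)) (trans gu≡gv (g-agrees v v∈W)))

  private
    lookup-classes : (c : Fin m) (v : Fin n) → (v ∉ W → g v ≢ c) →
      lookup (W ∩ colourClass f c) v ≡ lookup (colourClass g c) v
    lookup-classes c v outside rewrite lookup-zipWith _∧_ v W (colourClass f c)
                                     | lookup∘tabulate (λ u → ⌊ f u ≟ c ⌋) v
                                     | lookup∘tabulate (λ u → ⌊ g u ≟ c ⌋) v
      with v ∈? W
    ... | yes v∈W rewrite []=⇒lookup v∈W | g-agrees v v∈W = refl
    ... | no v∉W rewrite ∉⇒lookup≡false v∉W with g v ≟ c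
    ...   | yes gv≡c = ⊥-elim (outside v∉W gv≡c)
    ...   | no _ = refl

  classSize-extend : (c : Fin m) → (∀ v → v ∉ W → g v ≢ c) →
    classSize ⊤ g c ≡ classSize W f c
  classSize-extend c outside = begin
    ∣ ⊤ ∩ colourClass g c ∣  ≡⟨ cong ∣_∣ (∩-identityˡ (colourClass g c)) ⟩
    ∣ colourClass g c ∣      ≡⟨ cong ∣_∣ (lookup-ext (W ∩ colourClass f c) (colourClass g c)
                                                     (λ v → lookup-classes c v (outside v))) ⟨
    ∣ W ∩ colourClass f c ∣  ∎
    where open ≡-Reasoning

  classSize-extend-suc : (c : Fin m) (u : Fin n) → u ∉ W → g u ≡ c →
    (∀ v → v ∉ W → g v ≡ c → v ≡ u) → classSize ⊤ g c ≡ suc (classSize W f c)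
  classSize-extend-suc c u u∉W gu≡c only-u = begin
    ∣ ⊤ ∩ colourClass g c ∣  ≡⟨ cong ∣_∣ (∩-identityˡ (colourClass g c)) ⟩
    ∣ colourClass g c ∣      ≡⟨ ∣q∣≡1+∣p∣ (W ∩ colourClass f c) (colourClass g c) u u-before u-after others ⟩
    suc (classSize W f c)   ∎
    where
    open ≡-Reasoning
    u-before : lookup (W ∩ colourClass f c) u ≡ false
    u-before rewrite lookup-zipWith _∧_ u W (colourClass f c) | ∉⇒lookup≡false u∉W = refl
    u-after : lookup (colourClass g c) u ≡ true
    u-after rewrite lookup∘tabulate (λ v → ⌊ g v ≟ c ⌋) u | gu≡c with c ≟ c
    ... | yes _ = refl
    ... | no c≢c = ⊥-elim (c≢c refl)
    others : ∀ v → v ≢ u → lookup (W ∩ colourClass f c) v ≡ lookup (colourClass g c) v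
    others v v≢u = lookup-classes c v (λ v∉W gv≡c → v≢u (only-u v v∉W gv≡c))

Balanced : (Fin m → ℕ) → Set
Balanced {m} s = ∀ (c d : Fin m) → s c ≤ suc (s d)

balanced-raise-lowest : {s t : Fin m → ℕ} {C : Fin m → Set} → Decidable C → Balanced s →
  (∀ c d → C c → ¬ C d → s c ≤ s d) →
  (∀ c → C c → t c ≡ suc (s c)) → (∀ c → ¬ C c → t c ≡ s c) → Balanced t
balanced-raise-lowest C? s-balanced lowest raised kept c d with C? c | C? d
... | yes Cc | yes Cd rewrite raised c Cc | raised d Cd = s≤s (s-balanced c d)
... | yes Cc | no ¬Cd rewrite raised c Cc | kept d ¬Cd = s≤s (lowest c d Cc ¬Cd)
... | no ¬Cc | yes Cd rewrite kept c ¬Cc | raised d Cd = m≤n⇒m≤1+n (s-balanced c d)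
... | no ¬Cc | no ¬Cd rewrite kept c ¬Cc | kept d ¬Cd = s-balanced c d

-- The three smallest colour classes

Minimal : (w : Fin m → ℕ) → (Fin m → Set) → Fin m → Set
Minimal {m} w P t = P t × (∀ d → P d → w t ≤ w d)

minimal? : (w : Fin m → ℕ) {P : Fin m → Set} → Decidable P →
  (∀ d → ¬ P d) ⊎ ∃ (Minimal w P)
minimal? {zero} w P? = inj₁ (λ ())
minimal? {suc m} w P? with minimal? (w ∘ suc) (P? ∘ suc) | P? zero
... | inj₁ none | no ¬P0 = inj₁ λ { zero → ¬P0 ; (suc d) → none d }
... | inj₁ none | yes P0 = inj₂ (zero , P0 , λ { zero _ → ≤-refl ; (suc d) Pd → ⊥-elim (none d Pd) })
... | inj₂ (t , Pt , t-min) | no ¬P0 =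
  inj₂ (suc t , Pt , λ { zero P0 → ⊥-elim (¬P0 P0) ; (suc d) → t-min d })
... | inj₂ (t , Pt , t-min) | yes P0 with w zero ≤? w (suc t)
...   | yes w0≤wt = inj₂ (zero , P0 , λ { zero _ → ≤-refl ; (suc d) Pd → ≤-trans w0≤wt (t-min d Pd) })
...   | no w0≰wt = inj₂ (suc t , Pt , λ { zero _ → ≰⇒≥ w0≰wt ; (suc d) → t-min d })

minimal : (w : Fin m → ℕ) {P : Fin m → Set} → Decidable P → ∃ P → ∃ (Minimal w P)
minimal w P? (d , Pd) with minimal? w P?
... | inj₁ none = ⊥-elim (none d Pd)
... | inj₂ t = t

avoiding-two : ∀ {k} (a b : Fin (3 + k)) → ∃ λ d → d ≢ a × d ≢ b
avoiding-two a b with zero ≟ a | zero ≟ b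
... | no 0≢a | no 0≢b = zero , 0≢a , 0≢b
... | yes refl | _ with suc zero ≟ b
...   | no 1≢b = suc zero , (λ ()) , 1≢b
...   | yes refl = suc (suc zero) , (λ ()) , (λ ())
avoiding-two a b | no _ | yes refl with suc zero ≟ a
...   | no 1≢a = suc zero , 1≢a , (λ ())
...   | yes refl = suc (suc zero) , (λ ()) , (λ ())

record Lowest3 (w : Fin m → ℕ) (p q r : Fin m) : Set where
  field
    p≢q : p ≢ q
    p≢r : p ≢ r
    q≢r : q ≢ r
    lowest : ∀ c d → OneOf p q r c → ¬ OneOf p q r d → w c ≤ w d

oneOf? : (p q r c : Fin m) → Dec (OneOf p q r c)
oneOf? p q r c = c ≟ p ⊎-dec c ≟ q ⊎-dec c ≟ r

lowest-three : 3 ≤ m → (w : Fin m → ℕ) → ∃[ p ] ∃[ q ] ∃[ r ] Lowest3 w p q r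
lowest-three (s≤s (s≤s (s≤s _))) w
  with minimal w (λ _ → yes tt) (zero , tt)
... | p , _ , p-low with minimal w (λ d → ¬? (d ≟ p)) (map₂ proj₁ (avoiding-two p p))
... | q , q≢p , q-low with minimal w (λ d → ¬? (d ≟ p) ×-dec ¬? (d ≟ q)) (avoiding-two p q)
... | r , (r≢p , r≢q) , r-low = p , q , r , record
  { p≢q = ≢-sym q≢p
  ; p≢r = ≢-sym r≢p
  ; q≢r = ≢-sym r≢q
  ; lowest = λ { _ d (inj₁ refl) d∉ → p-low d tt
               ; _ d (inj₂ (inj₁ refl)) d∉ → q-low d (d∉ ∘ inj₁)
               ; _ d (inj₂ (inj₂ refl)) d∉ → r-low d (d∉ ∘ inj₁ , d∉ ∘ inj₂ ∘ inj₁) } }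

no-three-distinct-in-pair : {A : Set} {p q r a e : A} → p ≢ q → p ≢ r → q ≢ r →
  p ≡ a ⊎ p ≡ e → q ≡ a ⊎ q ≡ e → r ≡ a ⊎ r ≡ e → ⊥
no-three-distinct-in-pair p≢q _ _ (inj₁ refl) (inj₁ refl) _ = p≢q refl
no-three-distinct-in-pair p≢q _ _ (inj₂ refl) (inj₂ refl) _ = p≢q refl
no-three-distinct-in-pair _ p≢r _ (inj₁ refl) _ (inj₁ refl) = p≢r refl
no-three-distinct-in-pair _ p≢r _ (inj₂ refl) _ (inj₂ refl) = p≢r refl
no-three-distinct-in-pair _ _ q≢r _ (inj₁ refl) (inj₁ refl) = q≢r refl
no-three-distinct-in-pair _ _ q≢r _ (inj₂ refl) (inj₂ refl) = q≢r refl

module _ {w : Fin m → ℕ} where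

  swap₁₂ : {p q r : Fin m} → Lowest3 w p q r → Lowest3 w q p r
  swap₁₂ L = record
    { p≢q = ≢-sym p≢q ; p≢r = q≢r ; q≢r = p≢r
    ; lowest = λ c d c∈ d∉ → lowest c d (swap c∈) (d∉ ∘ swap) }
    where
    open Lowest3 L
    swap : ∀ {A : Set} {p q r c : A} → OneOf p q r c → OneOf q p r c
    swap (inj₁ c≡p) = inj₂ (inj₁ c≡p)
    swap (inj₂ (inj₁ c≡q)) = inj₁ c≡q
    swap (inj₂ (inj₂ c≡r)) = inj₂ (inj₂ c≡r)

  swap₂₃ : {p q r : Fin m} → Lowest3 w p q r → Lowest3 w p r q
  swap₂₃ L = record
    { p≢q = p≢r ; p≢r = p≢q ; q≢r = ≢-sym q≢r
    ; lowest = λ c d c∈ d∉ → lowest c d (swap c∈) (d∉ ∘ swap) }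
    where
    open Lowest3 L
    swap : ∀ {A : Set} {p q r c : A} → OneOf p r q c → OneOf p q r c
    swap (inj₁ c≡p) = inj₁ c≡p
    swap (inj₂ (inj₁ c≡r)) = inj₂ (inj₂ c≡r)
    swap (inj₂ (inj₂ c≡q)) = inj₂ (inj₁ c≡q)

  last-avoiding : {p q r : Fin m} → Lowest3 w p q r → (a e : Fin m) →
    ∃[ u ] ∃[ v ] ∃[ t ] Lowest3 w u v t × t ≢ a × t ≢ e
  last-avoiding {p} {q} {r} L a e with r ≟ a ⊎-dec r ≟ e | q ≟ a ⊎-dec q ≟ e | p ≟ a ⊎-dec p ≟ e
  ... | no r∉ | _ | _ = p , q , r , L , r∉ ∘ inj₁ , r∉ ∘ inj₂
  ... | yes _ | no q∉ | _ = p , r , q , swap₂₃ L , q∉ ∘ inj₁ , q∉ ∘ inj₂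
  ... | yes _ | yes _ | no p∉ = q , r , p , swap₂₃ (swap₁₂ L) , p∉ ∘ inj₁ , p∉ ∘ inj₂
  ... | yes r∈ | yes q∈ | yes p∈ = ⊥-elim (no-three-distinct-in-pair p≢q p≢r q≢r p∈ q∈ r∈)
    where open Lowest3 L

  first-two-avoiding : {u v t : Fin m} → Lowest3 w u v t → {a b : Fin m} → a ≢ b →
    ∃[ c₁ ] ∃[ c₂ ] Lowest3 w c₁ c₂ t × c₁ ≢ a × c₂ ≢ b
  first-two-avoiding {u} {v} L {a} {b} a≢b with u ≟ a | v ≟ b
  ... | no u≢a | no v≢b = u , v , L , u≢a , v≢b
  ... | yes refl | _ = v , u , swap₁₂ L , ≢-sym (Lowest3.p≢q L) , a≢b
  ... | no _ | yes refl = v , u , swap₁₂ L , ≢-sym a≢b , Lowest3.p≢q L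

module Threads {G : Graph n} {x y₁ y₂ y y₃ z : Fin n}
  (T : TwoThread G x y₁ y₂ y) (O : OneThread G x y₃ z) (x≢y : x ≢ y) (x≢z : x ≢ z) where

  open TwoThread T using (x≢a; x≢b; a≢b; a≢y; b≢y; adj-xa; adj-ab; adj-by; deg-a; deg-b; deg-y)
  open OneThread O using (x≢c; c≢z; adj-xc; adj-cz; deg-c; deg-z)

  y₁-neighbour : ∀ {r} → Adj G y₁ r → r ≡ x ⊎ r ≡ y₂
  y₁-neighbour = neighbour-of-degree-two G deg-a (Adj-sym G adj-xa) adj-ab x≢b

  y₂-neighbour : ∀ {r} → Adj G y₂ r → r ≡ y₁ ⊎ r ≡ y
  y₂-neighbour = neighbour-of-degree-two G deg-b (Adj-sym G adj-ab) adj-by a≢y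

  y₃-neighbour : ∀ {r} → Adj G y₃ r → r ≡ x ⊎ r ≡ z
  y₃-neighbour = neighbour-of-degree-two G deg-c (Adj-sym G adj-xc) adj-cz x≢z

  y₁≢y₃ : y₁ ≢ y₃
  y₁≢y₃ refl with y₁-neighbour adj-cz
  ... | inj₁ z≡x = x≢z (sym z≡x)
  ... | inj₂ z≡y₂ = degree-two≢degree-≥3 G deg-b deg-z (sym z≡y₂)

  y₂≢y₃ : y₂ ≢ y₃
  y₂≢y₃ refl with y₂-neighbour (Adj-sym G adj-xc)
  ... | inj₁ x≡y₁ = x≢a x≡y₁
  ... | inj₂ x≡y = x≢y x≡y

  W : Subset n
  W = without3 y₁ y₂ y₃

  x∈W : x ∈ W
  x∈W = ∈without3⁺ x≢a x≢b x≢c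

  y∈W : y ∈ W
  y∈W = ∈without3⁺ (≢-sym a≢y) (≢-sym b≢y) (≢-sym (degree-two≢degree-≥3 G deg-c deg-y))

  z∈W : z ∈ W
  z∈W = ∈without3⁺ (≢-sym (degree-two≢degree-≥3 G deg-a deg-z))
                   (≢-sym (degree-two≢degree-≥3 G deg-b deg-z)) (≢-sym c≢z)

module Extension {G : Graph n} {x y₁ y₂ y y₃ z : Fin n}
  (T : TwoThread G x y₁ y₂ y) (O : OneThread G x y₃ z) (x≢y : x ≢ y) (x≢z : x ≢ z)
  (f : Fin n → Fin m) (f-proper : ProperOn G (without3 y₁ y₂ y₃) f)
  (f-balanced : BalancedOn (without3 y₁ y₂ y₃) f) {c₁ c₂ c₃ : Fin m}
  (L : Lowest3 (classSize (without3 y₁ y₂ y₃) f) c₁ c₂ c₃)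
  (c₁≢fx : c₁ ≢ f x) (c₂≢fy : c₂ ≢ f y) (c₃≢fx : c₃ ≢ f x) (c₃≢fz : c₃ ≢ f z) where

  open Threads T O x≢y x≢z
  open Lowest3 L using (p≢q; p≢r; q≢r; lowest)

  g₁ g₂ g : Fin n → Fin m
  g₁ = updateAt f y₁ (const c₁)
  g₂ = updateAt g₁ y₂ (const c₂)
  g = updateAt g₂ y₃ (const c₃)

  g-y₁ : g y₁ ≡ c₁
  g-y₁ = trans (updateAt-minimal y₁ y₃ g₂ y₁≢y₃)
        (trans (updateAt-minimal y₁ y₂ g₁ (TwoThread.a≢b T)) (updateAt-updates y₁ f))

  g-y₂ : g y₂ ≡ c₂
  g-y₂ = trans (updateAt-minimal y₂ y₃ g₂ y₂≢y₃) (updateAt-updates y₂ g₁)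

  g-y₃ : g y₃ ≡ c₃
  g-y₃ = updateAt-updates y₃ g₂

  g-agrees : ∀ v → v ∈ W → g v ≡ f v
  g-agrees v v∈W with ∈without3⁻ v∈W
  ... | v≢y₁ , v≢y₂ , v≢y₃ = trans (updateAt-minimal v y₃ g₂ v≢y₃)
        (trans (updateAt-minimal v y₂ g₁ v≢y₂) (updateAt-minimal v y₁ f v≢y₁))

  differ : ∀ {u v a b} → g u ≡ a → g v ≡ b → a ≢ b → g u ≢ g v
  differ gu≡a gv≡b a≢b gu≡gv = a≢b (trans (sym gu≡a) (trans gu≡gv gv≡b))

  g-proper : ProperOn G ⊤ g
  g-proper = properOn-extend g-agrees {G} f-proper λ u v u∉W uv → outer (∉without3⁻ u∉W) uv
    where
    gx : g x ≡ f x
    gx = g-agrees x x∈W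
    outer : ∀ {u v} → OneOf y₁ y₂ y₃ u → Adj G u v → g u ≢ g v
    outer (inj₁ refl) uv with y₁-neighbour uv
    ... | inj₁ refl = differ g-y₁ gx c₁≢fx
    ... | inj₂ refl = differ g-y₁ g-y₂ p≢q
    outer (inj₂ (inj₁ refl)) uv with y₂-neighbour uv
    ... | inj₁ refl = differ g-y₂ g-y₁ (≢-sym p≢q)
    ... | inj₂ refl = differ g-y₂ (g-agrees y y∈W) c₂≢fy
    outer (inj₂ (inj₂ refl)) uv with y₃-neighbour uv
    ... | inj₁ refl = differ g-y₃ gx c₃≢fx
    ... | inj₂ refl = differ g-y₃ (g-agrees z z∈W) c₃≢fz

  g-outside : ∀ {v} → v ∉ W → OneOf c₁ c₂ c₃ (g v)
  g-outside v∉W with ∉without3⁻ v∉W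
  ... | inj₁ refl = inj₁ g-y₁
  ... | inj₂ (inj₁ refl) = inj₂ (inj₁ g-y₂)
  ... | inj₂ (inj₂ refl) = inj₂ (inj₂ g-y₃)

  g-injective-outside : ∀ {u v} → u ∉ W → v ∉ W → g u ≡ g v → u ≡ v
  g-injective-outside u∉W v∉W = go (∉without3⁻ u∉W) (∉without3⁻ v∉W)
    where
    go : ∀ {u v} → OneOf y₁ y₂ y₃ u → OneOf y₁ y₂ y₃ v → g u ≡ g v → u ≡ v
    go (inj₁ refl) (inj₁ refl) _ = refl
    go (inj₂ (inj₁ refl)) (inj₂ (inj₁ refl)) _ = refl
    go (inj₂ (inj₂ refl)) (inj₂ (inj₂ refl)) _ = refl
    go (inj₁ refl) (inj₂ (inj₁ refl)) = ⊥-elim ∘ differ g-y₁ g-y₂ p≢q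
    go (inj₁ refl) (inj₂ (inj₂ refl)) = ⊥-elim ∘ differ g-y₁ g-y₃ p≢r
    go (inj₂ (inj₁ refl)) (inj₁ refl) = ⊥-elim ∘ differ g-y₂ g-y₁ (≢-sym p≢q)
    go (inj₂ (inj₁ refl)) (inj₂ (inj₂ refl)) = ⊥-elim ∘ differ g-y₂ g-y₃ q≢r
    go (inj₂ (inj₂ refl)) (inj₁ refl) = ⊥-elim ∘ differ g-y₃ g-y₁ (≢-sym p≢r)
    go (inj₂ (inj₂ refl)) (inj₂ (inj₁ refl)) = ⊥-elim ∘ differ g-y₃ g-y₂ (≢-sym q≢r)

  raised-at : ∀ {u c} → u ∉ W → g u ≡ c → classSize ⊤ g c ≡ suc (classSize W f c)
  raised-at {u} {c} u∉W gu≡c = classSize-extend-suc g-agrees c u u∉W gu≡c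
    (λ v v∉W gv≡c → g-injective-outside v∉W u∉W (trans gv≡c (sym gu≡c)))

  g-raised : ∀ c → OneOf c₁ c₂ c₃ c → classSize ⊤ g c ≡ suc (classSize W f c)
  g-raised _ (inj₁ refl) = raised-at a∉without3 g-y₁
  g-raised _ (inj₂ (inj₁ refl)) = raised-at b∉without3 g-y₂
  g-raised _ (inj₂ (inj₂ refl)) = raised-at c∉without3 g-y₃

  g-kept : ∀ c → ¬ OneOf c₁ c₂ c₃ c → classSize ⊤ g c ≡ classSize W f c
  g-kept c c∉ = classSize-extend g-agrees c
    (λ v v∉W gv≡c → c∉ (subst (OneOf c₁ c₂ c₃) gv≡c (g-outside v∉W)))

  g-balanced : BalancedOn ⊤ g
  g-balanced = balanced-raise-lowest (oneOf? c₁ c₂ c₃) f-balanced lowest g-raised g-kept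

lemma3p3 : ∀ {n} (G : Graph n) (x y₁ y₂ y y₃ z : Fin n) (m : ℕ) →
    TwoThread G x y₁ y₂ y → OneThread G x y₃ z → 4 ≤ m →
    (f : Fin n → Fin m) → EquitableOn G (without3 y₁ y₂ y₃) f →
    f x ≢ f y → f x ≢ f z →
    Σ (Fin n → Fin m) (λ g → EquitableOn G ⊤ g ×
    (∀ v → v ∈ without3 y₁ y₂ y₃ → g v ≡ f v))
lemma3p3 G x y₁ y₂ y y₃ z m T O 4≤m f (f-proper , f-balanced) fx≢fy fx≢fz
  with lowest-three (<⇒≤ 4≤m) (classSize (without3 y₁ y₂ y₃) f)
... | _ , _ , _ , L with last-avoiding L (f x) (f z)
... | _ , _ , _ , L′ , c₃≢fx , c₃≢fz with first-two-avoiding L′ fx≢fy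
... | _ , _ , L″ , c₁≢fx , c₂≢fy = g , (g-proper , g-balanced) , g-agrees
  where
  open Extension T O (λ x≡y → fx≢fy (cong f x≡y)) (λ x≡z → fx≢fz (cong f x≡z))
                 f f-proper f-balanced L″ c₁≢fx c₂≢fy c₃≢fx c₃≢fz
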